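{- Let $a,b$ be positive integers. Define $c^{(a, b)}_{1} := -K^{\mathfrak{L}}_{(a+1,b-1), (a, b)}$ and, recursively for $2\le i\le b$, \[ c^{(a, b)}_{i} := -\left( K^{\mathfrak{L}}_{(a+i,b-i), (a, b)} + \sum_{j=1}^{i-1} c^{(a, b)}_{j} K^{\mathfrak{L}}_{(a+i,b-i),(a+j,b-j)} \right). \] Then \[ \mathfrak{L}_{(a, b)} = H_{(a, b)} + c_{1}^{(a, b)} H_{(a+1, b-1)} + c_{2}^{(a, b)} H_{(a+2,b-2)} + \cdots + c_{b}^{(a, b)} H_{(a+b)}. \]
   Context: Convention: a tuple with a trailing zero part, such as $(a+b,0)$, is identified with the composition obtained by deleting the zero, e.g. $(a+b)$. A composition $\alpha \vDash n$ is a tuple of positive integers summing to $n$; its diagram has left-justified rows, row $i$ (from the bottom) with $\alpha_i$ cells. A word is a necklace word if it is lexicographically weakly smallest among its cyclic shifts. A lexical tableau of shape $\alpha$ and type $\beta$ is a filling of the diagram of $\alpha$ with positive integers in which $i$ appears $\beta_i$ times, the first column strictly increases from the bottom row upward, and every row read left to right is a necklace word; $K^{\mathfrak{L}}_{\alpha,\beta}$ is their number. $\mathsf{NSym}$ is the algebra of noncommutative symmetric functions over $\mathbb{Q}$ with complete homogeneous basis $\{H_\alpha\}$, dual to the quasisymmetric functions $\mathsf{QSym}$ via $\langle H_\alpha,M_\beta\rangle=\delta_{\alpha,\beta}$ ($M_\beta$ the monomial quasisymmetric functions). The dual lexical function is $\mathfrak{L}^*_\alpha=\sum_T x^T$ over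 lexical tableaux $T$ of shape $\alpha$, where $x^T=\prod_i x_i^{\#\{\text{entries equal to }i\}}$; the lexical basis $\{\mathfrak{L}_\alpha\}$ of $\mathsf{NSym}$ is the unique basis with $\langle\mathfrak{L}_\alpha,\mathfrak{L}^*_\beta\rangle=\delta_{\alpha,\beta}$. -}

module Defs where

open import Data.Bool using (Bool; true; false; _∧_; _∨_; if_then_else_; T)
open import Data.Nat using (ℕ; zero; suc; _+_; _∸_; _≤_; s≤s; _<ᵇ_; _≡ᵇ_)
open import Data.List using (List; []; _∷_; _++_; map; concatMap; concat; length; take; drop; upTo; zipWith; last)
open import Data.Nat.ListAction using (sum)
import Data.List.Properties as LP
open import Data.Maybe using (just; nothing)
open import Data.Product using (Σ; _×_; _,_; proj₁; proj₂)
open import Data.Integer using (+_)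
open import Data.Rational using (ℚ; 0ℚ; 1ℚ; _/_) renaming (_+_ to _+ℚ_; _*_ to _*ℚ_; -_ to -ℚ_)
import Data.Nat.Properties as NP
open import Relation.Nullary.Decidable using (⌊_⌋)

pos : ℕ → Bool
pos zero    = false
pos (suc _) = true

isComp : List ℕ → Bool
isComp []       = true
isComp (x ∷ xs) = pos x ∧ isComp xs

Comp : Set
Comp = Σ (List ℕ) (λ l → T (isComp l))

-- the tuple (x , y), with the convention that a trailing zero part is deleted
twoPart : ℕ → ℕ → List ℕ
twoPart x zero    = x ∷ []
twoPart x (suc y) = x ∷ suc y ∷ []

twoPart-isComp : ∀ n y → T (isComp (twoPart (suc n) y))
twoPart-isComp n zero    = _
twoPart-isComp n (suc y) = _

twoComp : (a b : ℕ) → 1 ≤ a → Comp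
twoComp (suc a) b (s≤s _) = twoPart (suc a) b , twoPart-isComp a b

oneTo : ℕ → List ℕ
oneTo m = map suc (upTo m)

words : ℕ → ℕ → List (List ℕ)
words m zero    = [] ∷ []
words m (suc r) = concatMap (λ x → map (x ∷_) (words m r)) (oneTo m)

-- all fillings of the diagram of α (rows listed from the bottom) with entries in {1,…,m}
fillings : ℕ → List ℕ → List (List (List ℕ))
fillings m []       = [] ∷ []
fillings m (r ∷ rs) = concatMap (λ w → map (w ∷_) (fillings m rs)) (words m r)

allB : {A : Set} → (A → Bool) → List A → Bool
allB p []       = true
allB p (x ∷ xs) = p x ∧ allB p xs

countB : {A : Set} → (A → Bool) → List A → ℕ
countB p []       = 0
countB p (x ∷ xs) = if p x then suc (countB p xs) else countB p xs

lexLeq : List ℕ → List ℕ → Bool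
lexLeq []       _        = true
lexLeq (x ∷ xs) []       = false
lexLeq (x ∷ xs) (y ∷ ys) = (x <ᵇ y) ∨ ((x ≡ᵇ y) ∧ lexLeq xs ys)

rotate : ℕ → List ℕ → List ℕ
rotate k w = drop k w ++ take k w

isNecklace : List ℕ → Bool
isNecklace w = allB (λ k → lexLeq w (rotate k w)) (upTo (length w))

firstColumn : List (List ℕ) → List ℕ
firstColumn []             = []
firstColumn ([] ∷ rs)      = firstColumn rs
firstColumn ((x ∷ _) ∷ rs) = x ∷ firstColumn rs

strictlyIncreasing : List ℕ → Bool
strictlyIncreasing []           = true
strictlyIncreasing (x ∷ [])     = true
strictlyIncreasing (x ∷ y ∷ xs) = (x <ᵇ y) ∧ strictlyIncreasing (y ∷ xs)

-- β_i (1-indexed), zero beyond the length of β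
part : List ℕ → ℕ → ℕ
part []       _       = 0
part (b ∷ bs) zero    = 0
part (b ∷ bs) (suc zero) = b
part (b ∷ bs) (suc (suc i)) = part bs (suc i)

countEntry : ℕ → List (List ℕ) → ℕ
countEntry i t = countB (λ x → x ≡ᵇ i) (concat t)

isLexical : List ℕ → List (List ℕ) → Bool
isLexical β t =
  allB (λ i → countEntry i t ≡ᵇ part β i) (oneTo (sum β))
  ∧ strictlyIncreasing (firstColumn t)
  ∧ allB isNecklace t

-- K^𝔏_{α,β} : number of lexical tableaux of shape α and type β.
-- (Every entry i of such a tableau satisfies β_i > 0, hence i ≤ ℓ(β) ≤ |β|,
--  so enumerating fillings with entries in {1,…,|β|} is exhaustive.)
KL : List ℕ → List ℕ → ℕ
KL α β = countB (isLexical β) (fillings (sum β) α)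

ℕtoℚ : ℕ → ℚ
ℕtoℚ n = + n / 1

sumℚ : List ℚ → ℚ
sumℚ []       = 0ℚ
sumℚ (x ∷ xs) = x +ℚ sumℚ xs

-- the element Σ q H_γ over the listed terms (q , γ)
NSym : Set
NSym = List (ℚ × Comp)

eqList : List ℕ → List ℕ → Bool
eqList x y = ⌊ LP.≡-dec NP._≟_ x y ⌋

coeff : NSym → Comp → ℚ
coeff f γ = sumℚ (map (λ t → if eqList (proj₁ (proj₂ t)) (proj₁ γ) then proj₁ t else 0ℚ) f)

-- equality in NSym (the H_α form a basis)
_≈N_ : NSym → NSym → Set
f ≈N g = ∀ γ → coeff f γ ≡ coeff g γ
  where open import Relation.Binary.PropositionalEquality using (_≡_)

-- ⟨ f , 𝔏*_β ⟩, using ⟨ H_γ , 𝔏*_β ⟩ = coefficient of x_1^{γ_1}⋯x_k^{γ_k} in 𝔏*_β = K^𝔏_{β,γ}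
pairDual : NSym → Comp → ℚ
pairDual f β = sumℚ (map (λ t → proj₁ t *ℚ ℕtoℚ (KL (proj₁ β) (proj₁ (proj₂ t)))) f)

kronecker : Comp → Comp → ℚ
kronecker α β = if eqList (proj₁ α) (proj₁ β) then 1ℚ else 0ℚ

-- L is the lexical basis: ⟨ L_α , 𝔏*_β ⟩ = δ_{α,β}
IsLexicalBasis : (Comp → NSym) → Set
IsLexicalBasis L = ∀ α β → pairDual (L α) β ≡ kronecker α β
  where open import Relation.Binary.PropositionalEquality using (_≡_)

shape : ℕ → ℕ → ℕ → List ℕ
shape a b i = twoPart (a + i) (b ∸ i)

cList : ℕ → ℕ → ℕ → List ℚ
cList a b zero    = []
cList a b (suc i) =
  let prev = cList a b i in
  prev ++ (-ℚ (ℕtoℚ (KL (shape a b (suc i)) (twoPart a b))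
               +ℚ sumℚ (zipWith (λ j cj → cj *ℚ ℕtoℚ (KL (shape a b (suc i)) (shape a b j)))
                                (oneTo i) prev)) ∷ [])

-- c^{(a,b)}_i  (the last entry of [c_1, …, c_i]; i ≥ 1)
c : ℕ → ℕ → ℕ → ℚ
c a b i with last (cList a b i)
... | just x  = x
... | nothing = 0ℚ

expansion : (a b : ℕ) → 1 ≤ a → NSym
expansion (suc a) b (s≤s _) =
  (1ℚ , twoComp (suc a) b (s≤s Data.Nat.z≤n))
  ∷ map (λ i → c (suc a) b i , (shape (suc a) b i , twoPart-isComp (a + i) (b ∸ i))) (oneTo b)

-- A lexical tableau has a strictly increasing first column and necklace rows, so every row
-- starts with its smallest entry. Hence all entries equal to the smallest value still to be
-- placed lie in the lowest remaining row. Peeling off rows shows that a lexical tableau of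
-- shape β and type γ exists only if γ ≤ β lexicographically, and that for γ = β the only one
-- is the tableau whose i-th row is constantly i. So the pairing ⟨H_γ, 𝔏*_β⟩ = K_{β,γ} is
-- unitriangular, and an element of NSym is determined by its pairings with all 𝔏*_β: it
-- remains to check that the right-hand side pairs to δ_{(a,b),β}. For the type (a, b) the
-- same analysis leaves only the shapes (a + k, b − k), and on these the pairing vanishes by
-- the recursion defining the c_i.

module Submission where

open import Defs
open import Data.Nat using (ℕ; _≤_)
open import Data.Bool using (Bool; true; false; if_then_else_; T)
open import Data.Bool.Properties using (T-∧; T-∨; T-≡)
open import Data.Empty using (⊥-elim)
open import Data.List
  using ( List; []; _∷_; _++_; map; length; concat; concatMap; cartesianProductWith
        ; replicate; drop; take; upTo; last; zipWith )
import Data.List.Base as L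
import Data.List.Properties as List
open import Data.List.Membership.Propositional using (_∈_; find; lose)
open import Data.List.Membership.Propositional.Properties
  using (∈-map⁺; ∈-map⁻; ∈-upTo⁺; ∈-upTo⁻; ∈-cartesianProductWith⁺; ∈-cartesianProductWith⁻)
open import Data.List.Relation.Binary.Lex.Strict using (Lex-≤; base; halt; this; next; ≤-decTotalOrder)
open import Data.List.Relation.Binary.Pointwise using (Pointwise; []; _∷_; Pointwise-≡⇒≡)
open import Data.List.Relation.Unary.All using (All; []; _∷_)
import Data.List.Relation.Unary.All as All
import Data.List.Relation.Unary.All.Properties as Allₚ
open import Data.List.Relation.Unary.Any using (here; there; any?)
open import Data.List.Relation.Unary.Unique.Propositional using (Unique; []; _∷_)
import Data.List.Relation.Unary.Unique.Propositional.Properties as Unique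
open import Data.Maybe using (just)
open import Data.Nat using (zero; suc; _+_; _∸_; _<_; z≤n; s≤s; _≡ᵇ_; _≤?_)
import Data.Nat.Properties as ℕ
open import Data.Nat.ListAction using (sum)
open import Data.Product using (Σ; ∃; _×_; _,_; proj₁; proj₂; map₁)
open import Data.Rational using (ℚ; 0ℚ; 1ℚ) renaming (_+_ to _+ℚ_; _*_ to _*ℚ_; -_ to -ℚ_)
import Data.Rational.Properties as ℚ
open import Algebra.Properties.Group ℚ.+-0-group using (x∙y⁻¹≈ε⇒x≈y)
open import Data.Rational.Solver using (module +-*-Solver)
open import Data.Sum using (_⊎_; inj₁; inj₂)
open import Data.Unit using (tt)
open import Function using (_∘_; id)
open import Function.Bundles using (_⇔_; mk⇔; Equivalence)
open import Level using (0ℓ)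
open import Relation.Binary.Bundles using (DecTotalOrder)
open import Relation.Binary.PropositionalEquality
open import Relation.Nullary using (¬_; yes; no)
open import Relation.Nullary.Decidable using (fromWitness; decidable-stable)

open Equivalence using (to; from)

_≤lex_ : List ℕ → List ℕ → Set
_≤lex_ = Lex-≤ _≡_ _<_

lexOrder : DecTotalOrder 0ℓ 0ℓ 0ℓ
lexOrder = ≤-decTotalOrder ℕ.<-strictTotalOrder

≤lex-antisym : ∀ {xs ys} → xs ≤lex ys → ys ≤lex xs → xs ≡ ys
≤lex-antisym p q = Pointwise-≡⇒≡ (DecTotalOrder.antisym lexOrder p q)

≤lex-head : ∀ {x y xs ys} → (x ∷ xs) ≤lex (y ∷ ys) → x ≤ y
≤lex-head (this x<y)    = ℕ.<⇒≤ x<y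
≤lex-head (next refl _) = ℕ.≤-refl

-- Unitriangular pairings separate NSym

compOf : ℚ × Comp → List ℕ
compOf = proj₁ ∘ proj₂

-- pairDual f β is pairWith (λ γ → ℕtoℚ (KL (proj₁ β) γ)) f.
pairWith : (List ℕ → ℚ) → NSym → ℚ
pairWith φ f = sumℚ (map (λ t → proj₁ t *ℚ φ (compOf t)) f)

indicator : List ℕ → List ℕ → ℚ
indicator δ l = if eqList l δ then 1ℚ else 0ℚ

eqList-refl : ∀ x → eqList x x ≡ true
eqList-refl x = to T-≡ (fromWitness refl)

coeff≡pairWith-indicator : ∀ f γ → coeff f γ ≡ pairWith (indicator (proj₁ γ)) f
coeff≡pairWith-indicator []                γ = refl
coeff≡pairWith-indicator ((q , l , _) ∷ f) γ =
  cong₂ _+ℚ_ (scale (eqList l (proj₁ γ))) (coeff≡pairWith-indicator f γ)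
  where
  scale : ∀ b → (if b then q else 0ℚ) ≡ q *ℚ (if b then 1ℚ else 0ℚ)
  scale true  = sym (ℚ.*-identityʳ q)
  scale false = sym (ℚ.*-zeroʳ q)

pairWith-cong : ∀ {φ ψ} f → All (λ t → φ (compOf t) ≡ ψ (compOf t)) f → pairWith φ f ≡ pairWith ψ f
pairWith-cong []            []       = refl
pairWith-cong ((q , _) ∷ f) (e ∷ es) = cong₂ _+ℚ_ (cong (q *ℚ_) e) (pairWith-cong f es)

pairWith-++ : ∀ φ f g → pairWith φ (f ++ g) ≡ pairWith φ f +ℚ pairWith φ g
pairWith-++ φ []            g = sym (ℚ.+-identityˡ (pairWith φ g))
pairWith-++ φ ((q , γ) ∷ f) g =
  trans (cong (q *ℚ φ (proj₁ γ) +ℚ_) (pairWith-++ φ f g))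
        (sym (ℚ.+-assoc (q *ℚ φ (proj₁ γ)) (pairWith φ f) (pairWith φ g)))

negate : NSym → NSym
negate = map (map₁ -ℚ_)

pairWith-negate : ∀ φ f → pairWith φ (negate f) ≡ -ℚ pairWith φ f
pairWith-negate φ []            = refl
pairWith-negate φ ((q , γ) ∷ f) = begin
  -ℚ q *ℚ φ (proj₁ γ) +ℚ pairWith φ (negate f)
    ≡⟨ cong₂ _+ℚ_ (sym (ℚ.neg-distribˡ-* q (φ (proj₁ γ)))) (pairWith-negate φ f) ⟩
  -ℚ (q *ℚ φ (proj₁ γ)) +ℚ -ℚ pairWith φ f
    ≡⟨ sym (ℚ.neg-distrib-+ (q *ℚ φ (proj₁ γ)) (pairWith φ f)) ⟩
  -ℚ (q *ℚ φ (proj₁ γ) +ℚ pairWith φ f) ∎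
  where open ≡-Reasoning

pairWith-difference : ∀ φ f g → pairWith φ (f ++ negate g) ≡ pairWith φ f +ℚ -ℚ pairWith φ g
pairWith-difference φ f g = trans (pairWith-++ φ f (negate g)) (cong (pairWith φ f +ℚ_) (pairWith-negate φ g))

removeTerms : List ℕ → NSym → NSym
removeTerms δ []      = []
removeTerms δ (t ∷ f) = if eqList (compOf t) δ then removeTerms δ f else t ∷ removeTerms δ f

pairWith-split : ∀ φ δ f →
  pairWith φ f ≡ pairWith φ (removeTerms δ f) +ℚ pairWith (indicator δ) f *ℚ φ δ
pairWith-split φ δ []                = sym (trans (cong (0ℚ +ℚ_) (ℚ.*-zeroˡ (φ δ))) (ℚ.+-identityʳ 0ℚ))
pairWith-split φ δ ((q , l , _) ∷ f) with List.≡-dec ℕ._≟_ l δ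
... | yes refl rewrite pairWith-split φ δ f =
  solve 4 (λ q x r i → q :* x :+ (r :+ i :* x) := r :+ (q :* con 1ℚ :+ i) :* x) refl
    q (φ δ) (pairWith φ (removeTerms δ f)) (pairWith (indicator δ) f)
  where open +-*-Solver
... | no _ rewrite pairWith-split φ δ f =
  solve 5 (λ q y x r i → q :* y :+ (r :+ i :* x) := (q :* y :+ r) :+ (q :* con 0ℚ :+ i) :* x) refl
    q (φ l) (φ δ) (pairWith φ (removeTerms δ f)) (pairWith (indicator δ) f)
  where open +-*-Solver

pairWith-removeTerms : ∀ φ δ f → pairWith (indicator δ) f ≡ 0ℚ →
  pairWith φ (removeTerms δ f) ≡ pairWith φ f
pairWith-removeTerms φ δ f noTerms = sym (begin
  pairWith φ f                            ≡⟨ pairWith-split φ δ f ⟩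
  rest +ℚ pairWith (indicator δ) f *ℚ φ δ ≡⟨ cong (λ x → rest +ℚ x *ℚ φ δ) noTerms ⟩
  rest +ℚ 0ℚ *ℚ φ δ                       ≡⟨ cong (rest +ℚ_) (ℚ.*-zeroˡ (φ δ)) ⟩
  rest +ℚ 0ℚ                              ≡⟨ ℚ.+-identityʳ rest ⟩
  rest                                    ∎)
  where
  open ≡-Reasoning
  rest = pairWith φ (removeTerms δ f)

length-removeTerms≤ : ∀ δ f → length (removeTerms δ f) ≤ length f
length-removeTerms≤ δ []      = z≤n
length-removeTerms≤ δ (t ∷ f) with eqList (compOf t) δ
... | true  = ℕ.m≤n⇒m≤1+n (length-removeTerms≤ δ f)
... | false = s≤s (length-removeTerms≤ δ f)

length-removeTerms< : ∀ {t} f → t ∈ f → length (removeTerms (compOf t) f) < length f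
length-removeTerms< (t ∷ f) (here refl) rewrite eqList-refl (compOf t) =
  s≤s (length-removeTerms≤ (compOf t) f)
length-removeTerms< {t} (u ∷ f) (there t∈f) with eqList (compOf u) (compOf t)
... | true  = ℕ.m≤n⇒m≤1+n (length-removeTerms< f t∈f)
... | false = s≤s (length-removeTerms< f t∈f)

module Unitriangular
  (w : List ℕ → List ℕ → ℚ)
  (w-diag : ∀ γ → T (isComp γ) → w γ γ ≡ 1ℚ)
  (w-tri : ∀ β γ → T (isComp β) → T (isComp γ) → ¬ γ ≤lex β → w β γ ≡ 0ℚ)
  where

  open import Data.List.Extrema (DecTotalOrder.totalOrder lexOrder)
    using (argmin; argmin-sel; f[argmin]≤f[⊤]; f[argmin]≤f[xs])

  minimalTerm : ∀ t f → Σ (ℚ × Comp) λ m → m ∈ (t ∷ f) × All (λ u → compOf m ≤lex compOf u) (t ∷ f)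
  minimalTerm t f = argmin compOf t f , membership (argmin-sel compOf t f) ,
                    f[argmin]≤f[⊤] {f = compOf} t f ∷ f[argmin]≤f[xs] {f = compOf} t f
    where
    membership : ∀ {m} → m ≡ t ⊎ m ∈ f → m ∈ (t ∷ f)
    membership (inj₁ m≡t) = here m≡t
    membership (inj₂ m∈f) = there m∈f

  w≡indicator-above : ∀ (δ l : Comp) → proj₁ δ ≤lex proj₁ l →
    w (proj₁ δ) (proj₁ l) ≡ indicator (proj₁ δ) (proj₁ l)
  w≡indicator-above (δ , cδ) (l , cl) δ≤l with List.≡-dec ℕ._≟_ l δ
  ... | yes refl = w-diag δ cδ
  ... | no  l≢δ  = w-tri δ l cδ cl λ l≤δ → l≢δ (≤lex-antisym l≤δ δ≤l)

  -- Pairing with the functional of a lexicographically minimal term δ reads off the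
  -- coefficient of H_δ; so that coefficient vanishes and the terms on H_δ can be dropped.
  coefficients-vanish : ∀ n f → length f ≤ n → (∀ (β : Comp) → pairWith (w (proj₁ β)) f ≡ 0ℚ) →
    ∀ γ → pairWith (indicator γ) f ≡ 0ℚ
  coefficients-vanish n       []      _   _   γ = refl
  coefficients-vanish (suc n) (t ∷ f) len hyp γ with minimalTerm t f
  ... | m , m∈f , m≤f =
    trans (sym (pairWith-removeTerms (indicator γ) δ (t ∷ f) δ-coeff))
          (coefficients-vanish n (removeTerms δ (t ∷ f)) len′ hyp′ γ)
    where
    δ = compOf m
    δ-coeff : pairWith (indicator δ) (t ∷ f) ≡ 0ℚ
    δ-coeff = trans (sym (pairWith-cong (t ∷ f) (All.map (λ {u} → w≡indicator-above (proj₂ m) (proj₂ u)) m≤f)))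
                    (hyp (proj₂ m))
    len′ : length (removeTerms δ (t ∷ f)) ≤ n
    len′ = ℕ.≤-pred (ℕ.≤-trans (length-removeTerms< (t ∷ f) m∈f) len)
    hyp′ : ∀ (β : Comp) → pairWith (w (proj₁ β)) (removeTerms δ (t ∷ f)) ≡ 0ℚ
    hyp′ β = trans (pairWith-removeTerms (w (proj₁ β)) δ (t ∷ f) δ-coeff) (hyp β)

  ≈N-fromPairings : ∀ f g → (∀ (β : Comp) → pairWith (w (proj₁ β)) f ≡ pairWith (w (proj₁ β)) g) →
    f ≈N g
  ≈N-fromPairings f g hyp γ = x∙y⁻¹≈ε⇒x≈y (coeff f γ) (coeff g γ) (begin
    coeff f γ +ℚ -ℚ coeff g γ
      ≡⟨ cong₂ (λ x y → x +ℚ -ℚ y) (coeff≡pairWith-indicator f γ) (coeff≡pairWith-indicator g γ) ⟩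
    pairWith ι f +ℚ -ℚ pairWith ι g
      ≡⟨ sym (pairWith-difference ι f g) ⟩
    pairWith ι (f ++ negate g)
      ≡⟨ coefficients-vanish _ (f ++ negate g) ℕ.≤-refl pairings-vanish (proj₁ γ) ⟩
    0ℚ ∎)
    where
    open ≡-Reasoning
    ι = indicator (proj₁ γ)
    pairings-vanish : ∀ (β : Comp) → pairWith (w (proj₁ β)) (f ++ negate g) ≡ 0ℚ
    pairings-vanish β = trans (pairWith-difference (w (proj₁ β)) f g)
      (trans (cong (_+ℚ -ℚ pairWith (w (proj₁ β)) g) (hyp β)) (ℚ.+-inverseʳ (pairWith (w (proj₁ β)) g)))

-- Enumeration of fillings

oneTo-unique : ∀ m → Unique (oneTo m)
oneTo-unique m = Unique.map⁺ ℕ.suc-injective (Unique.upTo⁺ m)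

∈-oneTo⁺ : ∀ {i m} → i < m → suc i ∈ oneTo m
∈-oneTo⁺ i<m = ∈-map⁺ suc (∈-upTo⁺ i<m)

∈-oneTo⁻ : ∀ {x m} → x ∈ oneTo m → 1 ≤ x × x ≤ m
∈-oneTo⁻ x∈ with _ , i∈ , refl ← ∈-map⁻ suc x∈ = s≤s z≤n , ∈-upTo⁻ i∈

concatMap-prepend : ∀ {A : Set} (xs : List A) ys →
  concatMap (λ x → map (x ∷_) ys) xs ≡ cartesianProductWith L._∷_ xs ys
concatMap-prepend []       ys = refl
concatMap-prepend (x ∷ xs) ys = cong (map (x ∷_) ys ++_) (concatMap-prepend xs ys)

words-suc : ∀ m r → words m (suc r) ≡ cartesianProductWith L._∷_ (oneTo m) (words m r)
words-suc m r = concatMap-prepend (oneTo m) (words m r)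

fillings-∷ : ∀ m r α → fillings m (r ∷ α) ≡ cartesianProductWith L._∷_ (words m r) (fillings m α)
fillings-∷ m r α = concatMap-prepend (words m r) (fillings m α)

words-unique : ∀ m r → Unique (words m r)
words-unique m zero    = [] ∷ []
words-unique m (suc r) = subst Unique (sym (words-suc m r))
  (Unique.cartesianProductWith⁺ L._∷_ List.∷-injective (oneTo-unique m) (words-unique m r))

fillings-unique : ∀ m α → Unique (fillings m α)
fillings-unique m []      = [] ∷ []
fillings-unique m (r ∷ α) = subst Unique (sym (fillings-∷ m r α))
  (Unique.cartesianProductWith⁺ L._∷_ List.∷-injective (words-unique m r) (fillings-unique m α))

IsWord : ℕ → ℕ → List ℕ → Set
IsWord m r w = length w ≡ r × All (_∈ oneTo m) w

∈-words⁺ : ∀ {m} r {w} → IsWord m r w → w ∈ words m r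
∈-words⁺     zero    (refl , [])        = here refl
∈-words⁺ {m} (suc r) (refl , x∈ ∷ w∈) =
  subst (_ ∈_) (sym (words-suc m r)) (∈-cartesianProductWith⁺ L._∷_ x∈ (∈-words⁺ r (refl , w∈)))

∈-words⁻ : ∀ {m} r {w} → w ∈ words m r → IsWord m r w
∈-words⁻     zero    (here refl) = refl , []
∈-words⁻ {m} (suc r) w∈
  with _ , _ , x∈ , v∈ , refl ←
         ∈-cartesianProductWith⁻ L._∷_ (oneTo m) (words m r) (subst (_ ∈_) (words-suc m r) w∈)
  with refl , v∈m ← ∈-words⁻ r v∈
  = refl , x∈ ∷ v∈m

∈-fillings⁺ : ∀ {m} α {t} → Pointwise (IsWord m) α t → t ∈ fillings m α
∈-fillings⁺     []      []       = here refl
∈-fillings⁺ {m} (r ∷ α) (w ∷ ws) =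
  subst (_ ∈_) (sym (fillings-∷ m r α)) (∈-cartesianProductWith⁺ L._∷_ (∈-words⁺ r w) (∈-fillings⁺ α ws))

∈-fillings⁻ : ∀ {m} α {t} → t ∈ fillings m α → Pointwise (IsWord m) α t
∈-fillings⁻     []      (here refl) = []
∈-fillings⁻ {m} (r ∷ α) t∈
  with _ , _ , w∈ , t′∈ , refl ←
         ∈-cartesianProductWith⁻ L._∷_ (words m r) (fillings m α) (subst (_ ∈_) (fillings-∷ m r α) t∈)
  = ∈-words⁻ r w∈ ∷ ∈-fillings⁻ α t′∈

countB-≡0 : ∀ {A : Set} (p : A → Bool) xs → (∀ {y} → y ∈ xs → ¬ T (p y)) → countB p xs ≡ 0
countB-≡0 p []       none = refl
countB-≡0 p (x ∷ xs) none with p x | none (here refl)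
... | true  | ¬px = ⊥-elim (¬px _)
... | false | _   = countB-≡0 p xs (none ∘ there)

countB-≡1 : ∀ {A : Set} (p : A → Bool) {xs x} → Unique xs → x ∈ xs → T (p x) →
  (∀ {y} → y ∈ xs → T (p y) → y ≡ x) → countB p xs ≡ 1
countB-≡1 p {x ∷ xs} (x∉ ∷ _) (here refl) _ only with p x
... | true = cong suc (countB-≡0 p xs λ y∈ py → All.lookup x∉ y∈ (sym (only (there y∈) py)))
countB-≡1 p {y ∷ xs} (y∉ ∷ u) (there x∈) px only with p y | only (here refl)
... | true  | y≡x = ⊥-elim (All.lookup y∉ x∈ (y≡x _))
... | false | _   = countB-≡1 p u x∈ px (only ∘ there)

countB-≢0 : ∀ {A : Set} (p : A → Bool) xs → countB p xs ≢ 0 → ∃ λ x → x ∈ xs × T (p x)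
countB-≢0 p []       c≢0 = ⊥-elim (c≢0 refl)
countB-≢0 p (x ∷ xs) c≢0 with p x in px
... | true  = x , here refl , subst T (sym px) _
... | false with y , y∈ , py ← countB-≢0 p xs c≢0 = y , there y∈ , py

-- Lexical tableaux

≡ᵇ-refl : ∀ x → (x ≡ᵇ x) ≡ true
≡ᵇ-refl zero    = refl
≡ᵇ-refl (suc x) = ≡ᵇ-refl x

count : ℕ → List ℕ → ℕ
count x = countB (_≡ᵇ x)

count-++ : ∀ x u v → count x (u ++ v) ≡ count x u + count x v
count-++ x []      v = refl
count-++ x (y ∷ u) v with y ≡ᵇ x
... | true  = cong suc (count-++ x u v)
... | false = count-++ x u v

count≤length : ∀ x w → count x w ≤ length w
count≤length x []      = z≤n
count≤length x (y ∷ w) with y ≡ᵇ x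
... | true  = s≤s (count≤length x w)
... | false = ℕ.m≤n⇒m≤1+n (count≤length x w)

count≡length⇒constant : ∀ x w → count x w ≡ length w → All (_≡ x) w
count≡length⇒constant x []      _ = []
count≡length⇒constant x (y ∷ w) c with y ≡ᵇ x in y≡x
... | true  = ℕ.≡ᵇ⇒≡ y x (subst T (sym y≡x) _) ∷ count≡length⇒constant x w (ℕ.suc-injective c)
... | false = ⊥-elim (ℕ.<-irrefl c (s≤s (count≤length x w)))

count-absent : ∀ x w → All (_≢ x) w → count x w ≡ 0
count-absent x w ≢x = countB-≡0 (_≡ᵇ x) w λ y∈ y≡ᵇx → All.lookup ≢x y∈ (ℕ.≡ᵇ⇒≡ _ x y≡ᵇx)

count-replicate : ∀ n x → count x (replicate n x) ≡ n
count-replicate zero    x = refl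
count-replicate (suc n) x rewrite ≡ᵇ-refl x = cong suc (count-replicate n x)

count-∈ : ∀ {x} w → x ∈ w → 1 ≤ count x w
count-∈ {x} (y ∷ w) (here refl) rewrite ≡ᵇ-refl x = s≤s z≤n
count-∈ {x} (y ∷ w) (there x∈) with y ≡ᵇ x
... | true  = s≤s z≤n
... | false = count-∈ w x∈

constant⇒replicate : ∀ {A : Set} {x : A} w → All (_≡ x) w → w ≡ replicate (length w) x
constant⇒replicate []      []          = refl
constant⇒replicate (y ∷ w) (refl ∷ ≡x) = cong (y ∷_) (constant⇒replicate w ≡x)

data Ascending : ℕ → List (List ℕ) → Set where
  []   : ∀ {s} → Ascending s []
  step : ∀ {s h ws t} → s < h → All (h ≤_) ws → Ascending h t → Ascending s ((h ∷ ws) ∷ t)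

Content : ℕ → List ℕ → List (List ℕ) → Set
Content s γ t = ∀ i → countEntry (suc i + s) t ≡ part γ (suc i)

canonical : ℕ → List ℕ → List (List ℕ)
canonical s []      = []
canonical s (g ∷ γ) = replicate g (suc s) ∷ canonical (suc s) γ

ascending-entries : ∀ {s t} → Ascending s t → All (s <_) (concat t)
ascending-entries []                  = []
ascending-entries (step s<h h≤ws asc) =
  Allₚ.++⁺ (s<h ∷ All.map (ℕ.<-≤-trans s<h) h≤ws) (All.map (ℕ.<-trans s<h) (ascending-entries asc))

firstRow-count : ∀ {s h ws t x} → Ascending s ((h ∷ ws) ∷ t) → x ≤ h →
  count x (concat ((h ∷ ws) ∷ t)) ≡ count x (h ∷ ws)
firstRow-count {h = h} {ws} {t} {x} (step _ _ asc) x≤h = begin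
  count x ((h ∷ ws) ++ concat t)        ≡⟨ count-++ x (h ∷ ws) (concat t) ⟩
  count x (h ∷ ws) + count x (concat t) ≡⟨ cong (count x (h ∷ ws) +_) (count-absent x (concat t) above-h) ⟩
  count x (h ∷ ws) + 0                  ≡⟨ ℕ.+-identityʳ _ ⟩
  count x (h ∷ ws)                      ∎
  where
  open ≡-Reasoning
  above-h : All (_≢ x) (concat t)
  above-h = All.map (λ h<y y≡x → ℕ.<-irrefl (sym y≡x) (ℕ.≤-<-trans x≤h h<y)) (ascending-entries asc)

firstRow-content : ∀ {s h ws t g γ} → Ascending s ((h ∷ ws) ∷ t) → Content s (g ∷ γ) ((h ∷ ws) ∷ t) →
  count (suc s) (h ∷ ws) ≡ g
firstRow-content asc@(step s<h _ _) content = trans (sym (firstRow-count asc s<h)) (content 0)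

count-pastConstantRow : ∀ {s} ws t i → All (_≡ suc s) ws →
  countEntry (suc (suc i) + s) (ws ∷ t) ≡ countEntry (suc i + suc s) t
count-pastConstantRow {s} ws t i constant = begin
  count (suc (suc i) + s) (ws ++ concat t)
    ≡⟨ count-++ _ ws (concat t) ⟩
  count (suc (suc i) + s) ws + count (suc (suc i) + s) (concat t)
    ≡⟨ cong (_+ count (suc (suc i) + s) (concat t)) (count-absent _ ws (All.map below constant)) ⟩
  count (suc (suc i) + s) (concat t)
    ≡⟨ cong (λ x → count x (concat t)) (sym (ℕ.+-suc (suc i) s)) ⟩
  count (suc i + suc s) (concat t) ∎
  where
  open ≡-Reasoning
  below : ∀ {y} → y ≡ suc s → y ≢ suc (suc i) + s
  below refl = ℕ.<⇒≢ (s≤s (s≤s (ℕ.m≤n+m s i)))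

peel : ∀ {s h ws t g γ} → Ascending s ((h ∷ ws) ∷ t) → Content s (g ∷ γ) ((h ∷ ws) ∷ t) →
  All (_≡ suc s) (h ∷ ws) → Ascending (suc s) t × Content (suc s) γ t
peel {t = t} (step _ _ asc) content constant@(refl ∷ _) =
  asc , λ i → trans (sym (count-pastConstantRow _ t i constant)) (content (suc i))

-- Entries s + 1 can only occur in the first row, since the later rows lie above its head.
content≤lex-shape : ∀ {s γ t} → Ascending s t → Content s γ t → T (isComp γ) → γ ≤lex map length t
content≤lex-shape {γ = []}        []           _ _ = base tt
content≤lex-shape {γ = suc g ∷ γ} []           content _ with () ← content 0
content≤lex-shape {γ = []}        (step _ _ _) _ _ = halt
content≤lex-shape {s} {γ = suc g ∷ γ} asc@(step {h = h} {ws} _ _ _) content cγ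
  with ℕ.m≤n⇒m<n∨m≡n (subst (_≤ length (h ∷ ws)) (firstRow-content asc content)
                                                  (count≤length (suc s) (h ∷ ws)))
... | inj₁ g<len = this g<len
... | inj₂ g≡len
  with asc′ , content′ ←
         peel asc content (count≡length⇒constant (suc s) (h ∷ ws) (trans (firstRow-content asc content) g≡len))
  = next g≡len (content≤lex-shape asc′ content′ cγ)

content⇒canonical : ∀ {s t} → Ascending s t → Content s (map length t) t → t ≡ canonical s (map length t)
content⇒canonical []                                  _       = refl
content⇒canonical {s} asc@(step {h = h} {ws} _ _ _) content
  with constant ← count≡length⇒constant (suc s) (h ∷ ws) (firstRow-content asc content)
  with asc′ , content′ ← peel asc content constant
  = cong₂ (λ r rs → r ∷ rs) (constant⇒replicate (h ∷ ws) constant) (content⇒canonical asc′ content′)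

allB⇒All : ∀ {A : Set} (p : A → Bool) xs → T (allB p xs) → All (T ∘ p) xs
allB⇒All p []       _   = []
allB⇒All p (x ∷ xs) all = proj₁ (to T-∧ all) ∷ allB⇒All p xs (proj₂ (to T-∧ all))

All⇒allB : ∀ {A : Set} (p : A → Bool) {xs} → All (T ∘ p) xs → T (allB p xs)
All⇒allB p []         = tt
All⇒allB p (px ∷ pxs) = from T-∧ (px , All⇒allB p pxs)

lexLeq-head : ∀ {x y xs ys} → T (lexLeq (x ∷ xs) (y ∷ ys)) → x ≤ y
lexLeq-head {x} {y} leq with to T-∨ leq
... | inj₁ x<y      = ℕ.<⇒≤ (ℕ.<ᵇ⇒< x y x<y)
... | inj₂ x≡y∧leq = ℕ.≤-reflexive (ℕ.≡ᵇ⇒≡ x y (proj₁ (to T-∧ x≡y∧leq)))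

lexLeq-refl : ∀ w → T (lexLeq w w)
lexLeq-refl []      = tt
lexLeq-refl (x ∷ w) = from T-∨ (inj₂ (from T-∧ (ℕ.≡⇒≡ᵇ x x refl , lexLeq-refl w)))

All-fromDrops : ∀ {A : Set} {P : A → Set} xs → (∀ k {y ys} → drop k xs ≡ y ∷ ys → P y) → All P xs
All-fromDrops []       _ = []
All-fromDrops (x ∷ xs) f = f 0 refl ∷ All-fromDrops xs (f ∘ suc)

drop≡∷⇒< : ∀ {A : Set} k (xs : List A) {y ys} → drop k xs ≡ y ∷ ys → k < length xs
drop≡∷⇒< zero    (x ∷ xs) _  = s≤s z≤n
drop≡∷⇒< (suc k) (x ∷ xs) eq = s≤s (drop≡∷⇒< k xs eq)

necklace-head≤ : ∀ {h} ws → T (isNecklace (h ∷ ws)) → All (h ≤_) ws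
necklace-head≤ {h} ws necklace = All-fromDrops ws head≤
  where
  head≤ : ∀ k {y ys} → drop k ws ≡ y ∷ ys → h ≤ y
  head≤ k {y} {ys} eq = lexLeq-head {xs = ws} {ys = ys ++ take (suc k) (h ∷ ws)}
    (subst (λ v → T (lexLeq (h ∷ ws) (v ++ take (suc k) (h ∷ ws)))) eq
      (All.lookup (allB⇒All _ (upTo (suc (length ws))) necklace) (∈-upTo⁺ (s≤s (drop≡∷⇒< k ws eq)))))

ascending-from : ∀ {m s β t} → T (isComp β) → Pointwise (IsWord m) β t →
  T (strictlyIncreasing (s ∷ firstColumn t)) → T (allB isNecklace t) → Ascending s t
ascending-from _  []                _ _ = []
ascending-from () ((refl , []) ∷ _) _ _
ascending-from {s = s} {β = suc _ ∷ _} cβ ((_ , _ ∷ _) ∷ pw) increasing necklaces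
  with s<h , increasing′ ← to T-∧ increasing | necklace , necklaces′ ← to T-∧ necklaces
  = step (ℕ.<ᵇ⇒< s _ s<h) (necklace-head≤ _ necklace) (ascending-from cβ pw increasing′ necklaces′)

lexical⇒ascending : ∀ {m β t} → T (isComp β) → Pointwise (IsWord m) β t →
  T (strictlyIncreasing (firstColumn t)) → T (allB isNecklace t) → Ascending 0 t
lexical⇒ascending _  []                   _ _ = []
lexical⇒ascending () ((refl , []) ∷ _)    _ _
lexical⇒ascending cβ pw@((_ , h∈ ∷ _) ∷ _) increasing necklaces =
  ascending-from cβ pw (from T-∧ (ℕ.<⇒<ᵇ (proj₁ (∈-oneTo⁻ h∈)) , increasing)) necklaces

length≤sum : ∀ γ → T (isComp γ) → length γ ≤ sum γ
length≤sum []          _  = z≤n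
length≤sum (suc g ∷ γ) cγ = s≤s (ℕ.≤-trans (length≤sum γ cγ) (ℕ.m≤n+m (sum γ) g))

part-beyond : ∀ γ {i} → length γ ≤ i → part γ (suc i) ≡ 0
part-beyond []                        _ = refl
part-beyond (g ∷ γ) {suc i} (s≤s len) = part-beyond γ len

lexical⇒content : ∀ {γ t} → T (isComp γ) → All (_∈ oneTo (sum γ)) (concat t) →
  T (allB (λ i → countEntry i t ≡ᵇ part γ i) (oneTo (sum γ))) → Content 0 γ t
lexical⇒content {γ} {t} cγ entries counts i rewrite ℕ.+-identityʳ i with suc i ≤? sum γ
... | yes i<m = ℕ.≡ᵇ⇒≡ _ _ (All.lookup (allB⇒All _ (oneTo (sum γ)) counts) (∈-oneTo⁺ i<m))
... | no  i≮m = trans (count-absent (suc i) (concat t) (All.map beyond entries))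
                      (sym (part-beyond γ (ℕ.≤-trans (length≤sum γ cγ) (ℕ.≤-pred (ℕ.≰⇒> i≮m)))))
  where
  beyond : ∀ {y} → y ∈ oneTo (sum γ) → y ≢ suc i
  beyond y∈ refl = i≮m (proj₂ (∈-oneTo⁻ y∈))

filling-shape : ∀ {m β t} → Pointwise (IsWord m) β t → map length t ≡ β
filling-shape []               = refl
filling-shape ((len , _) ∷ pw) = cong₂ (λ r rs → r ∷ rs) len (filling-shape pw)

filling-entries : ∀ {m β t} → Pointwise (IsWord m) β t → All (_∈ oneTo m) (concat t)
filling-entries []                   = []
filling-entries ((_ , entries) ∷ pw) = Allₚ.++⁺ entries (filling-entries pw)

isLexical⇔ : ∀ γ t → T (isLexical γ t) ⇔
  ( T (allB (λ i → countEntry i t ≡ᵇ part γ i) (oneTo (sum γ)))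
  × T (strictlyIncreasing (firstColumn t))
  × T (allB isNecklace t) )
isLexical⇔ γ t = mk⇔ (λ lexical → let counts , rest = to T-∧ lexical in counts , to T-∧ rest)
                     (λ (counts , increasing , necklaces) → from T-∧ (counts , from T-∧ (increasing , necklaces)))

lexical-structure : ∀ {β γ t} → T (isComp β) → T (isComp γ) → t ∈ fillings (sum γ) β → T (isLexical γ t) →
  map length t ≡ β × Ascending 0 t × Content 0 γ t
lexical-structure {β} {γ} {t} cβ cγ t∈ lexical
  with counts , increasing , necklaces ← to (isLexical⇔ γ t) lexical
  = filling-shape pw
  , lexical⇒ascending {sum γ} {β} {t} cβ pw increasing necklaces
  , lexical⇒content {γ} {t} cγ (filling-entries {sum γ} pw) counts
  where
  pw = ∈-fillings⁻ {sum γ} β t∈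

drop-replicate : ∀ {A : Set} k n (x : A) → drop k (replicate n x) ≡ replicate (n ∸ k) x
drop-replicate zero    n       x = refl
drop-replicate (suc k) zero    x = refl
drop-replicate (suc k) (suc n) x = drop-replicate k n x

replicate-++-∷ : ∀ {A : Set} n (x : A) ys → replicate n x ++ (x ∷ ys) ≡ x ∷ (replicate n x ++ ys)
replicate-++-∷ zero    x ys = refl
replicate-++-∷ (suc n) x ys = cong (x ∷_) (replicate-++-∷ n x ys)

rotate-replicate : ∀ k n (x : ℕ) → rotate k (replicate n x) ≡ replicate n x
rotate-replicate zero    n       x = List.++-identityʳ (replicate n x)
rotate-replicate (suc k) zero    x = refl
rotate-replicate (suc k) (suc n) x = begin
  drop k (replicate n x) ++ (x ∷ prefix)  ≡⟨ cong (_++ (x ∷ prefix)) (drop-replicate k n x) ⟩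
  replicate (n ∸ k) x ++ (x ∷ prefix)     ≡⟨ replicate-++-∷ (n ∸ k) x prefix ⟩
  x ∷ (replicate (n ∸ k) x ++ prefix)     ≡⟨ cong (λ d → x ∷ (d ++ prefix)) (sym (drop-replicate k n x)) ⟩
  x ∷ rotate k (replicate n x)            ≡⟨ cong (x ∷_) (rotate-replicate k n x) ⟩
  x ∷ replicate n x                       ∎
  where
  open ≡-Reasoning
  prefix = take k (replicate n x)

replicate-isNecklace : ∀ n x → T (isNecklace (replicate n x))
replicate-isNecklace n x =
  All⇒allB (λ k → lexLeq (replicate n x) (rotate k (replicate n x))) {upTo (length (replicate n x))}
    (All.tabulate λ {k} _ →
      subst (T ∘ lexLeq (replicate n x)) (sym (rotate-replicate k n x)) (lexLeq-refl (replicate n x)))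

canonical-entries : ∀ s γ → All (s <_) (concat (canonical s γ))
canonical-entries s []      = []
canonical-entries s (g ∷ γ) =
  Allₚ.++⁺ (Allₚ.replicate⁺ g (ℕ.n<1+n s)) (All.map (ℕ.<-trans (ℕ.n<1+n s)) (canonical-entries (suc s) γ))

canonical-content : ∀ s γ → Content s γ (canonical s γ)
canonical-content s []      i       = refl
canonical-content s (g ∷ γ) zero    = begin
  count (suc s) (replicate g (suc s) ++ concat rest)
    ≡⟨ count-++ (suc s) (replicate g (suc s)) (concat rest) ⟩
  count (suc s) (replicate g (suc s)) + count (suc s) (concat rest)
    ≡⟨ cong₂ _+_ (count-replicate g (suc s)) (count-absent (suc s) (concat rest) above) ⟩
  g + 0
    ≡⟨ ℕ.+-identityʳ g ⟩
  g ∎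
  where
  open ≡-Reasoning
  rest = canonical (suc s) γ
  above : All (_≢ suc s) (concat rest)
  above = All.map (λ s<y y≡s → ℕ.<-irrefl (sym y≡s) s<y) (canonical-entries (suc s) γ)
canonical-content s (g ∷ γ) (suc i) =
  trans (count-pastConstantRow (replicate g (suc s)) (canonical (suc s) γ) i (Allₚ.replicate⁺ g refl))
        (canonical-content (suc s) γ i)

canonical-isWord : ∀ {m} s γ → s + length γ ≤ m → Pointwise (IsWord m) γ (canonical s γ)
canonical-isWord     s []      _    = []
canonical-isWord {m} s (g ∷ γ) fits =
  (List.length-replicate g , Allₚ.replicate⁺ g (∈-oneTo⁺ s<m)) ∷ canonical-isWord (suc s) γ fits′
  where
  fits′ : suc s + length γ ≤ m
  fits′ = subst (_≤ m) (ℕ.+-suc s (length γ)) fits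
  s<m : s < m
  s<m = ℕ.≤-trans (s≤s (ℕ.m≤m+n s (length γ))) fits′

canonical-firstColumn : ∀ s γ → T (isComp γ) → T (strictlyIncreasing (s ∷ firstColumn (canonical s γ)))
canonical-firstColumn s []          _  = tt
canonical-firstColumn s (suc g ∷ γ) cγ = from T-∧ (ℕ.<⇒<ᵇ (ℕ.n<1+n s) , canonical-firstColumn (suc s) γ cγ)

strictlyIncreasing-tail : ∀ x xs → T (strictlyIncreasing (x ∷ xs)) → T (strictlyIncreasing xs)
strictlyIncreasing-tail x []      _          = tt
strictlyIncreasing-tail x (y ∷ _) increasing = proj₂ (to T-∧ increasing)

canonical-necklaces : ∀ s γ → T (allB isNecklace (canonical s γ))
canonical-necklaces s []      = tt
canonical-necklaces s (g ∷ γ) = from T-∧ (replicate-isNecklace g (suc s) , canonical-necklaces (suc s) γ)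

content⇒counts : ∀ {γ t} → Content 0 γ t → All (λ i → T (countEntry i t ≡ᵇ part γ i)) (oneTo (sum γ))
content⇒counts {γ} {t} content = All.tabulate λ i∈ → countᵇ (proj₁ (∈-oneTo⁻ i∈))
  where
  countᵇ : ∀ {i} → 1 ≤ i → T (countEntry i t ≡ᵇ part γ i)
  countᵇ {suc i} _ =
    ℕ.≡⇒≡ᵇ _ _ (subst (λ x → countEntry x t ≡ part γ (suc i)) (ℕ.+-identityʳ (suc i)) (content i))

canonical-isLexical : ∀ γ → T (isComp γ) → T (isLexical γ (canonical 0 γ))
canonical-isLexical γ cγ = from (isLexical⇔ γ (canonical 0 γ))
  ( All⇒allB (λ i → countEntry i (canonical 0 γ) ≡ᵇ part γ i)
             (content⇒counts {γ} {canonical 0 γ} (canonical-content 0 γ))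
  , strictlyIncreasing-tail 0 (firstColumn (canonical 0 γ)) (canonical-firstColumn 0 γ cγ)
  , canonical-necklaces 0 γ )

KL-triangular : ∀ β γ → T (isComp β) → T (isComp γ) → KL β γ ≢ 0 → γ ≤lex β
KL-triangular β γ cβ cγ KL≢0
  with t , t∈ , lexical ← countB-≢0 (isLexical γ) (fillings (sum γ) β) KL≢0
  with shape , asc , content ← lexical-structure {β} {γ} {t} cβ cγ t∈ lexical
  = subst (γ ≤lex_) shape (content≤lex-shape asc content cγ)

KL-diagonal : ∀ γ → T (isComp γ) → KL γ γ ≡ 1
KL-diagonal γ cγ =
  countB-≡1 (isLexical γ) (fillings-unique (sum γ) γ)
    (∈-fillings⁺ γ (canonical-isWord 0 γ (length≤sum γ cγ))) (canonical-isLexical γ cγ) unique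
  where
  unique : ∀ {t} → t ∈ fillings (sum γ) γ → T (isLexical γ t) → t ≡ canonical 0 γ
  unique {t} t∈ lexical with refl , asc , content ← lexical-structure {γ} {γ} {t} cγ cγ t∈ lexical =
    content⇒canonical asc content

-- Tableaux of type (a, b)

twoLetter-length : ∀ w → All (λ e → 1 ≤ e × e ≤ 2) w → length w ≡ count 1 w + count 2 w
twoLetter-length []      []                                = refl
twoLetter-length (1 ∷ w) ((s≤s z≤n , s≤s z≤n) ∷ es)       = cong suc (twoLetter-length w es)
twoLetter-length (2 ∷ w) ((s≤s z≤n , s≤s (s≤s z≤n)) ∷ es) =
  trans (cong suc (twoLetter-length w es)) (sym (ℕ.+-suc (count 1 w) (count 2 w)))

-- Since the heads of the rows strictly increase, there are at most two rows, and the second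
-- one contains no 1.
twoRow-shape : ∀ {t} → Ascending 0 t → All (λ e → 1 ≤ e × e ≤ 2) (concat t) → 1 ≤ count 1 (concat t) →
  ∃ λ k → k ≤ count 2 (concat t) × map length t ≡ twoPart (count 1 (concat t) + k) (count 2 (concat t) ∸ k)
twoRow-shape [] _ ()
twoRow-shape {r ∷ []} (step _ _ []) bounds _ = c₂ , ℕ.≤-refl , (begin
  length r ∷ []                ≡⟨ cong (λ w → length w ∷ []) (sym (List.++-identityʳ r)) ⟩
  length (r ++ []) ∷ []        ≡⟨ cong (_∷ []) (twoLetter-length (r ++ []) bounds) ⟩
  twoPart (c₁ + c₂) 0          ≡⟨ cong (twoPart (c₁ + c₂)) (sym (ℕ.n∸n≡0 c₂)) ⟩
  twoPart (c₁ + c₂) (c₂ ∸ c₂)  ∎)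
  where
  open ≡-Reasoning
  c₁ = count 1 (r ++ [])
  c₂ = count 2 (r ++ [])
twoRow-shape {u ∷ v@(_ ∷ _) ∷ []} (step 0<h₁ _ upper@(step _ _ [])) bounds _ =
  count 2 u , ℕ.≤-trans (ℕ.m≤m+n (count 2 u) (count 2 v′)) (ℕ.≤-reflexive (sym (count-++ 2 u v′))) ,
  sym (cong₂ twoPart first second)
  where
  open ≡-Reasoning
  v′ = v ++ []
  no-1s : count 1 v′ ≡ 0
  no-1s = count-absent 1 v′
    (All.map (λ h₁<e e≡1 → ℕ.<-irrefl (sym e≡1) (ℕ.≤-<-trans 0<h₁ h₁<e)) (ascending-entries upper))
  first : count 1 (u ++ v′) + count 2 u ≡ length u
  first = begin
    count 1 (u ++ v′) + count 2 u       ≡⟨ cong (_+ count 2 u) (count-++ 1 u v′) ⟩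
    count 1 u + count 1 v′ + count 2 u  ≡⟨ cong (λ n → count 1 u + n + count 2 u) no-1s ⟩
    count 1 u + 0 + count 2 u           ≡⟨ cong (_+ count 2 u) (ℕ.+-identityʳ (count 1 u)) ⟩
    count 1 u + count 2 u               ≡⟨ sym (twoLetter-length u (Allₚ.++⁻ˡ u bounds)) ⟩
    length u                            ∎
  second : count 2 (u ++ v′) ∸ count 2 u ≡ length v
  second = begin
    count 2 (u ++ v′) ∸ count 2 u       ≡⟨ cong (_∸ count 2 u) (count-++ 2 u v′) ⟩
    count 2 u + count 2 v′ ∸ count 2 u  ≡⟨ ℕ.m+n∸m≡n (count 2 u) (count 2 v′) ⟩
    count 2 v′                          ≡⟨ cong (_+ count 2 v′) (sym no-1s) ⟩
    count 1 v′ + count 2 v′             ≡⟨ sym (twoLetter-length v′ (Allₚ.++⁻ʳ u bounds)) ⟩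
    length v′                           ≡⟨ cong length (List.++-identityʳ v) ⟩
    length v                            ∎
twoRow-shape {r₁ ∷ r₂ ∷ _} (step 0<h₁ _ (step h₁<h₂ _ (step h₂<h₃ _ _))) bounds _
  with (_ , h₃≤2) ∷ _ ← Allₚ.++⁻ʳ r₂ (Allₚ.++⁻ʳ r₁ bounds)
  = ⊥-elim (ℕ.<-irrefl refl
      (ℕ.≤-trans (s≤s (s≤s 0<h₁)) (ℕ.≤-trans (s≤s h₁<h₂) (ℕ.≤-trans h₂<h₃ h₃≤2))))

part-twoPart₁ : ∀ n y → part (twoPart (suc n) y) 1 ≡ suc n
part-twoPart₁ n zero    = refl
part-twoPart₁ n (suc y) = refl

part-twoPart₂ : ∀ n y → part (twoPart (suc n) y) 2 ≡ y
part-twoPart₂ n zero    = refl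
part-twoPart₂ n (suc y) = refl

part-twoPart₃₊ : ∀ n y i → part (twoPart (suc n) y) (3 + i) ≡ 0
part-twoPart₃₊ n zero    i = refl
part-twoPart₃₊ n (suc y) i = refl

twoPartContent-shape : ∀ {n y t} → Ascending 0 t → Content 0 (twoPart (suc n) y) t →
  ∃ λ k → k ≤ y × map length t ≡ twoPart (suc n + k) (y ∸ k)
twoPartContent-shape {n} {y} {t} asc content =
  subst₂ (λ x y → ∃ λ k → k ≤ y × map length t ≡ twoPart (x + k) (y ∸ k)) ones twos
    (twoRow-shape asc bounds (subst (1 ≤_) (sym ones) (s≤s z≤n)))
  where
  ones : count 1 (concat t) ≡ suc n
  ones = trans (content 0) (part-twoPart₁ n y)
  twos : count 2 (concat t) ≡ y
  twos = trans (content 1) (part-twoPart₂ n y)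
  atMost2 : ∀ {e} → e ∈ concat t → e ≤ 2
  atMost2 {0}           _  = z≤n
  atMost2 {1}           _  = s≤s z≤n
  atMost2 {2}           _  = s≤s (s≤s z≤n)
  atMost2 {suc (suc (suc i))} e∈ = ⊥-elim (ℕ.<-irrefl (sym absent) (count-∈ (concat t) e∈))
    where
    absent : count (3 + i) (concat t) ≡ 0
    absent = trans (cong (λ x → count x (concat t)) (sym (ℕ.+-identityʳ (3 + i))))
                   (trans (content (2 + i)) (part-twoPart₃₊ n y i))
  bounds : All (λ e → 1 ≤ e × e ≤ 2) (concat t)
  bounds = All.zipWith (λ (positive , e∈) → positive , atMost2 e∈) (ascending-entries asc , All.tabulate id)

KL-twoPart : ∀ {β} n y → T (isComp β) → KL β (twoPart (suc n) y) ≢ 0 →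
  ∃ λ k → k ≤ y × β ≡ twoPart (suc n + k) (y ∸ k)
KL-twoPart {β} n y cβ KL≢0
  with t , t∈ , lexical ← countB-≢0 (isLexical (twoPart (suc n) y)) (fillings (sum (twoPart (suc n) y)) β) KL≢0
  with refl , asc , content ← lexical-structure {β} {twoPart (suc n) y} {t} cβ (twoPart-isComp n y) t∈ lexical
  = twoPartContent-shape asc content

-- The pairing of the right-hand side with the dual lexical basis

KLℚ : List ℕ → List ℕ → ℚ
KLℚ β γ = ℕtoℚ (KL β γ)

KLℚ-triangular : ∀ β γ → T (isComp β) → T (isComp γ) → ¬ γ ≤lex β → KLℚ β γ ≡ 0ℚ
KLℚ-triangular β γ cβ cγ γ≰β =
  cong ℕtoℚ (decidable-stable (KL β γ ℕ.≟ 0) (γ≰β ∘ KL-triangular β γ cβ cγ))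

∑ : (ℕ → ℚ) → ℕ → ℚ
∑ g n = sumℚ (map g (oneTo n))

sumℚ-++ : ∀ xs ys → sumℚ (xs ++ ys) ≡ sumℚ xs +ℚ sumℚ ys
sumℚ-++ []       ys = sym (ℚ.+-identityˡ (sumℚ ys))
sumℚ-++ (x ∷ xs) ys = trans (cong (x +ℚ_) (sumℚ-++ xs ys)) (sym (ℚ.+-assoc x (sumℚ xs) (sumℚ ys)))

oneTo-suc : ∀ n → oneTo (suc n) ≡ oneTo n ++ suc n ∷ []
oneTo-suc n = trans (cong (map suc) (sym (List.upTo-∷ʳ n))) (List.map-++ suc (upTo n) (n ∷ []))

∑-suc : ∀ g n → ∑ g (suc n) ≡ ∑ g n +ℚ g (suc n)
∑-suc g n = begin
  sumℚ (map g (oneTo (suc n)))              ≡⟨ cong (sumℚ ∘ map g) (oneTo-suc n) ⟩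
  sumℚ (map g (oneTo n ++ suc n ∷ []))      ≡⟨ cong sumℚ (List.map-++ g (oneTo n) (suc n ∷ [])) ⟩
  sumℚ (map g (oneTo n) ++ g (suc n) ∷ [])  ≡⟨ sumℚ-++ (map g (oneTo n)) (g (suc n) ∷ []) ⟩
  ∑ g n +ℚ (g (suc n) +ℚ 0ℚ)                ≡⟨ cong (∑ g n +ℚ_) (ℚ.+-identityʳ (g (suc n))) ⟩
  ∑ g n +ℚ g (suc n)                        ∎
  where open ≡-Reasoning

∑-truncate : ∀ g k d → (∀ j → k < j → j ≤ k + d → g j ≡ 0ℚ) → ∑ g (k + d) ≡ ∑ g k
∑-truncate g k zero    vanish = cong (∑ g) (ℕ.+-identityʳ k)
∑-truncate g k (suc d) vanish = begin
  ∑ g (k + suc d)                 ≡⟨ cong (∑ g) (ℕ.+-suc k d) ⟩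
  ∑ g (suc (k + d))               ≡⟨ ∑-suc g (k + d) ⟩
  ∑ g (k + d) +ℚ g (suc (k + d))  ≡⟨ cong₂ _+ℚ_ (∑-truncate g k d vanish′) last-vanishes ⟩
  ∑ g k +ℚ 0ℚ                     ≡⟨ ℚ.+-identityʳ (∑ g k) ⟩
  ∑ g k                           ∎
  where
  open ≡-Reasoning
  vanish′ : ∀ j → k < j → j ≤ k + d → g j ≡ 0ℚ
  vanish′ j k<j j≤ = vanish j k<j (ℕ.≤-trans j≤ (ℕ.+-monoʳ-≤ k (ℕ.n≤1+n d)))
  last-vanishes : g (suc (k + d)) ≡ 0ℚ
  last-vanishes = vanish (suc (k + d)) (s≤s (ℕ.m≤m+n k d)) (ℕ.≤-reflexive (sym (ℕ.+-suc k d)))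

last-∷ʳ : ∀ {A : Set} (xs : List A) x → last (xs ++ x ∷ []) ≡ just x
last-∷ʳ []           x = refl
last-∷ʳ (_ ∷ [])     x = refl
last-∷ʳ (_ ∷ y ∷ xs) x = last-∷ʳ (y ∷ xs) x

c-fromLast : ∀ a b i {x} → last (cList a b i) ≡ just x → c a b i ≡ x
c-fromLast a b i eq with last (cList a b i)
c-fromLast a b i refl | just _ = refl

zipWith-diagonal : ∀ {A B C : Set} (f : A → B → C) (g : A → B) xs →
  zipWith f xs (map g xs) ≡ map (λ x → f x (g x)) xs
zipWith-diagonal f g []       = refl
zipWith-diagonal f g (x ∷ xs) = cong (f x (g x) ∷_) (zipWith-diagonal f g xs)

cList≡map-c : ∀ a b i → cList a b i ≡ map (c a b) (oneTo i)
cList≡map-c a b zero    = refl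
cList≡map-c a b (suc i) = begin
  cList a b i ++ new ∷ []
    ≡⟨ cong₂ (λ cs x → cs ++ x ∷ []) (cList≡map-c a b i) (sym c≡new) ⟩
  map (c a b) (oneTo i) ++ c a b (suc i) ∷ []
    ≡⟨ sym (List.map-++ (c a b) (oneTo i) (suc i ∷ [])) ⟩
  map (c a b) (oneTo i ++ suc i ∷ [])
    ≡⟨ cong (map (c a b)) (sym (oneTo-suc i)) ⟩
  map (c a b) (oneTo (suc i)) ∎
  where
  open ≡-Reasoning
  new = -ℚ (KLℚ (shape a b (suc i)) (twoPart a b)
        +ℚ sumℚ (zipWith (λ j cj → cj *ℚ KLℚ (shape a b (suc i)) (shape a b j)) (oneTo i) (cList a b i)))
  c≡new : c a b (suc i) ≡ new
  c≡new = c-fromLast a b (suc i) (last-∷ʳ (cList a b i) new)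

c-suc : ∀ a b i → c a b (suc i) ≡
  -ℚ (KLℚ (shape a b (suc i)) (twoPart a b) +ℚ ∑ (λ j → c a b j *ℚ KLℚ (shape a b (suc i)) (shape a b j)) i)
c-suc a b i = trans (c-fromLast a b (suc i) (last-∷ʳ (cList a b i) _))
  (cong (λ cs → -ℚ (KLℚ (shape a b (suc i)) (twoPart a b) +ℚ sumℚ cs))
    (trans (cong (zipWith term (oneTo i)) (cList≡map-c a b i)) (zipWith-diagonal term (c a b) (oneTo i))))
  where
  term : ℕ → ℚ → ℚ
  term j cj = cj *ℚ KLℚ (shape a b (suc i)) (shape a b j)

twoPart-injectiveˡ : ∀ {x x′} y y′ → twoPart x y ≡ twoPart x′ y′ → x ≡ x′
twoPart-injectiveˡ zero    zero    refl = refl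
twoPart-injectiveˡ (suc _) (suc _) refl = refl
twoPart-injectiveˡ zero    (suc _) ()
twoPart-injectiveˡ (suc _) zero    ()

twoPart-≤lex : ∀ {x x′} y y′ → twoPart x y ≤lex twoPart x′ y′ → x ≤ x′
twoPart-≤lex zero    zero    = ≤lex-head
twoPart-≤lex zero    (suc _) = ≤lex-head
twoPart-≤lex (suc _) zero    = ≤lex-head
twoPart-≤lex (suc _) (suc _) = ≤lex-head

-- The paper's a is A = suc a here.
module ExpansionPairing (a b : ℕ) where

  A : ℕ
  A = suc a

  S : ℕ → List ℕ
  S = shape A b

  S-isComp : ∀ k → T (isComp (S k))
  S-isComp k = twoPart-isComp (a + k) (b ∸ k)

  S-zero : S 0 ≡ twoPart A b
  S-zero = cong (λ x → twoPart (suc x) b) (ℕ.+-identityʳ a)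

  KL-S-vanishes : ∀ {k j} → k < j → KL (S k) (S j) ≡ 0
  KL-S-vanishes {k} {j} k<j = decidable-stable (KL (S k) (S j) ℕ.≟ 0) λ KL≢0 →
    ℕ.<-irrefl refl (ℕ.<-≤-trans (ℕ.+-monoʳ-< A k<j)
      (twoPart-≤lex (b ∸ j) (b ∸ k) (KL-triangular (S k) (S j) (S-isComp k) (S-isComp j) KL≢0)))

  KL-offShape : ∀ {l} → T (isComp l) → (∀ k → k ≤ b → l ≢ S k) → ∀ {j} → j ≤ b → KL l (S j) ≡ 0
  KL-offShape {l} cl off {j} j≤b = decidable-stable (KL l (S j) ℕ.≟ 0) λ KL≢0 →
    let k , k≤ , l≡ = KL-twoPart (a + j) (b ∸ j) cl KL≢0 in
    off (j + k) (ℕ.≤-trans (ℕ.+-monoʳ-≤ j k≤) (ℕ.≤-reflexive (ℕ.m+[n∸m]≡n j≤b)))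
        (trans l≡ (cong₂ twoPart (cong suc (ℕ.+-assoc a j k)) (ℕ.∸-+-assoc b j k)))

  E : NSym
  E = expansion A b (s≤s z≤n)

  α : Comp
  α = twoComp A b (s≤s z≤n)

  pairWith-E : ∀ φ → pairWith φ E ≡ φ (twoPart A b) +ℚ ∑ (λ i → c A b i *ℚ φ (S i)) b
  pairWith-E φ = cong₂ _+ℚ_ (ℚ.*-identityˡ (φ (twoPart A b))) (cong sumℚ (sym (List.map-∘ (oneTo b))))

  term-vanishes : ∀ l j → KL l (S j) ≡ 0 → c A b j *ℚ KLℚ l (S j) ≡ 0ℚ
  term-vanishes l j KL≡0 = trans (cong (λ n → c A b j *ℚ ℕtoℚ n) KL≡0) (ℚ.*-zeroʳ (c A b j))

  pairing-S-zero : pairWith (KLℚ (S 0)) E ≡ 1ℚ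
  pairing-S-zero = begin
    pairWith (KLℚ (S 0)) E
      ≡⟨ pairWith-E (KLℚ (S 0)) ⟩
    KLℚ (S 0) (twoPart A b) +ℚ ∑ (λ i → c A b i *ℚ KLℚ (S 0) (S i)) b
      ≡⟨ cong₂ _+ℚ_ (cong (KLℚ (S 0)) (sym S-zero))
                    (∑-truncate _ 0 b λ j 0<j _ → term-vanishes (S 0) j (KL-S-vanishes 0<j)) ⟩
    KLℚ (S 0) (S 0) +ℚ 0ℚ
      ≡⟨ ℚ.+-identityʳ (KLℚ (S 0) (S 0)) ⟩
    KLℚ (S 0) (S 0)
      ≡⟨ cong ℕtoℚ (KL-diagonal (S 0) (S-isComp 0)) ⟩
    1ℚ ∎
    where open ≡-Reasoning

  pairing-S-suc : ∀ {i} → suc i ≤ b → pairWith (KLℚ (S (suc i))) E ≡ 0ℚ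
  pairing-S-suc {i} i<b = begin
    pairWith (KLℚ (S (suc i))) E
      ≡⟨ pairWith-E (KLℚ (S (suc i))) ⟩
    κ +ℚ ∑ g b
      ≡⟨ cong (λ n → κ +ℚ ∑ g n) (sym (ℕ.m+[n∸m]≡n i<b)) ⟩
    κ +ℚ ∑ g (suc i + (b ∸ suc i))
      ≡⟨ cong (κ +ℚ_) (∑-truncate g (suc i) (b ∸ suc i) λ j i<j _ →
                         term-vanishes (S (suc i)) j (KL-S-vanishes i<j)) ⟩
    κ +ℚ ∑ g (suc i)
      ≡⟨ cong (κ +ℚ_) (∑-suc g i) ⟩
    κ +ℚ (∑ g i +ℚ c A b (suc i) *ℚ KLℚ (S (suc i)) (S (suc i)))
      ≡⟨ cong₂ (λ x n → κ +ℚ (∑ g i +ℚ x *ℚ ℕtoℚ n))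
               (c-suc A b i) (KL-diagonal (S (suc i)) (S-isComp (suc i))) ⟩
    κ +ℚ (∑ g i +ℚ -ℚ (κ +ℚ ∑ g i) *ℚ 1ℚ)
      ≡⟨ solve 2 (λ x s → x :+ (s :+ :- (x :+ s) :* con 1ℚ) := con 0ℚ) refl κ (∑ g i) ⟩
    0ℚ ∎
    where
    open ≡-Reasoning
    open +-*-Solver
    κ = KLℚ (S (suc i)) (twoPart A b)
    g = λ j → c A b j *ℚ KLℚ (S (suc i)) (S j)

  pairing-offShape : ∀ {l} → T (isComp l) → (∀ k → k ≤ b → l ≢ S k) → pairWith (KLℚ l) E ≡ 0ℚ
  pairing-offShape {l} cl off = begin
    pairWith (KLℚ l) E
      ≡⟨ pairWith-E (KLℚ l) ⟩
    KLℚ l (twoPart A b) +ℚ ∑ (λ i → c A b i *ℚ KLℚ l (S i)) b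
      ≡⟨ cong₂ _+ℚ_ (cong (KLℚ l) (sym S-zero))
                    (∑-truncate _ 0 b λ j _ j≤b → term-vanishes l j (KL-offShape cl off j≤b)) ⟩
    KLℚ l (S 0) +ℚ 0ℚ
      ≡⟨ cong (λ n → ℕtoℚ n +ℚ 0ℚ) (KL-offShape cl off z≤n) ⟩
    0ℚ +ℚ 0ℚ
      ≡⟨ ℚ.+-identityʳ 0ℚ ⟩
    0ℚ ∎
    where open ≡-Reasoning

  kronecker-on : ∀ {l} (cl : T (isComp l)) → l ≡ twoPart A b → kronecker α (l , cl) ≡ 1ℚ
  kronecker-on cl refl rewrite eqList-refl (twoPart A b) = refl

  kronecker-off : ∀ {l} (cl : T (isComp l)) → l ≢ twoPart A b → kronecker α (l , cl) ≡ 0ℚ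
  kronecker-off {l} cl l≢ with List.≡-dec ℕ._≟_ (twoPart A b) l
  ... | yes eq = ⊥-elim (l≢ (sym eq))
  ... | no  _  = refl

  pairing-atShape : ∀ k → k ≤ b → (cl : T (isComp (S k))) → pairWith (KLℚ (S k)) E ≡ kronecker α (S k , cl)
  pairing-atShape zero    _   cl = trans pairing-S-zero (sym (kronecker-on cl S-zero))
  pairing-atShape (suc i) i<b cl = trans (pairing-S-suc i<b) (sym (kronecker-off cl λ eq →
    ℕ.<-irrefl (twoPart-injectiveˡ b (b ∸ suc i) (sym eq)) (ℕ.m<m+n A (s≤s z≤n))))

  pairing-expansion : ∀ (β : Comp) → pairWith (KLℚ (proj₁ β)) E ≡ kronecker α β
  pairing-expansion (l , cl) with any? (λ k → List.≡-dec ℕ._≟_ l (S k)) (upTo (suc b))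
  ... | yes found with k , k∈ , refl ← find found = pairing-atShape k (ℕ.≤-pred (∈-upTo⁻ k∈)) cl
  ... | no  none  =
    trans (pairing-offShape cl off) (sym (kronecker-off cl λ l≡ → off 0 z≤n (trans l≡ (sym S-zero))))
    where
    off : ∀ k → k ≤ b → l ≢ S k
    off k k≤b l≡ = none (lose (∈-upTo⁺ (s≤s k≤b)) l≡)

theorem4p13 : (a b : ℕ) (ha : 1 ≤ a) (hb : 1 ≤ b)
    → (L : Comp → NSym) → IsLexicalBasis L
    → L (twoComp a b ha) ≈N expansion a b ha
theorem4p13 (suc a) b (s≤s z≤n) _ L isLexicalBasis =
  ≈N-fromPairings (L α) E λ β → trans (isLexicalBasis α β) (sym (pairing-expansion β))
  where
  open ExpansionPairing a b
  open Unitriangular KLℚ (λ γ cγ → cong ℕtoℚ (KL-diagonal γ cγ)) KLℚ-triangular
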